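{- For every coalition $C\subseteq N$ and formulas $\varphi,\psi$, $\models\mathrm{Iab}_C(\varphi\rightarrow\psi)\rightarrow(\mathrm{Iab}_C\neg\varphi\wedge\mathrm{Iab}_C\psi)$.
   Context: $N$ is a finite non-empty set of agents; a coalition is any $C\subseteq N$, $\overline{C}=N\setminus C$. Formulas: $\varphi ::= p \mid \neg\varphi \mid (\varphi\wedge\psi) \mid [C]\varphi \mid \mathrm{Iab}_C\varphi$ over a countable set $\mathrm{Prop}$ of variables, with $\vee,\rightarrow,\leftrightarrow,\top,\bot$ as usual. A coalition model is $\mathcal{M}=(S,\{Act_i\}_{i\in N},o,V)$ with $S$ non-empty, each $Act_i$ non-empty, $o:S\times\prod_{i\in N}Act_i\to S$, $V:\mathrm{Prop}\to 2^S$; $Act_C=\prod_{i\in C}Act_i$ ($Act_\emptyset$ contains only the empty profile). $\mathcal{M},s\models[C]\varphi$ iff there is $\sigma_C\in Act_C$ such that for all $\sigma_{\overline{C}}\in Act_{\overline{C}}$, $\mathcal{M},o(s,\sigma_C,\sigma_{\overline{C}})\models\varphi$; $\mathcal{M},s\models\mathrm{Iab}_C\varphi$ iff $\mathcal{M},s\not\models[C]\varphi$; atoms and Boolean connectives as usual. $\models\varphi$ means $\varphi$ holds at every state of every coalition model over $N$. -}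

module Defs where

open import Data.Nat using (ℕ; suc)
open import Data.Fin using (Fin)
open import Data.Bool using (Bool; true; false; not; T)
open import Data.Unit using (tt)
open import Data.Empty using (⊥)
open import Data.Product using (Σ; _×_)
open import Relation.Nullary using (¬_)

-- Agents: N = Fin (suc k), a finite non-empty set.
-- A coalition C ⊆ N is its characteristic function.
Coalition : ℕ → Set
Coalition n = Fin n → Bool

co : ∀ {n} → Coalition n → Coalition n
co C i = not (C i)

data Form (n : ℕ) : Set where
  var  : ℕ → Form n
  ¬'   : Form n → Form n
  _∧'_ : Form n → Form n → Form n
  [_]' : Coalition n → Form n → Form n
  Iab  : Coalition n → Form n → Form n

_∨'_ : ∀ {n} → Form n → Form n → Form n
φ ∨' ψ = ¬' (¬' φ ∧' ¬' ψ)

_⇒'_ : ∀ {n} → Form n → Form n → Form n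
φ ⇒' ψ = ¬' (φ ∧' ¬' ψ)

record Model (n : ℕ) : Set₁ where
  field
    S     : Set
    s₀    : S
    Act   : Fin n → Set
    act₀  : (i : Fin n) → Act i
    o     : S → ((i : Fin n) → Act i) → S
    V     : ℕ → S → Set

-- A partial profile for a coalition C: one action for each member of C.
-- (For C = ∅ this type has exactly one element up to extensionality.)
Profile : ∀ {n} (M : Model n) → Coalition n → Set
Profile {n} M C = (i : Fin n) → T (C i) → Model.Act M i

join : ∀ {n} (M : Model n) (C : Coalition n) →
       Profile M C → Profile M (co C) → (i : Fin n) → Model.Act M i
join M C σ τ i = pick (C i) (σ i) (τ i)
  where
  pick : (b : Bool) → (T b → Model.Act M i) → (T (not b) → Model.Act M i) → Model.Act M i
  pick true  f g = f tt
  pick false f g = g tt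

_,_⊨_ : ∀ {n} (M : Model n) → Model.S M → Form n → Set
M , s ⊨ var p = Model.V M p s
M , s ⊨ ¬' φ = ¬ (M , s ⊨ φ)
M , s ⊨ (φ ∧' ψ) = (M , s ⊨ φ) × (M , s ⊨ ψ)
M , s ⊨ [ C ]' φ = Σ (Profile M C) λ σ → (τ : Profile M (co C)) →
                     M , Model.o M s (join M C σ τ) ⊨ φ
M , s ⊨ Iab C φ = ¬ (Σ (Profile M C) λ σ → (τ : Profile M (co C)) →
                     M , Model.o M s (join M C σ τ) ⊨ φ)

Valid : ∀ {n} → Form n → Set₁
Valid {n} φ = (M : Model n) (s : Model.S M) → M , s ⊨ φ

module Submission where

open import Defs
open import Data.Nat using (ℕ; suc)
open import Data.Product using (_,_)

-- Both ¬ φ and ψ entail φ → ψ, so an ability to enforce either of them is an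
-- ability to enforce φ → ψ; lacking the latter, the coalition lacks both.

[]-mono : ∀ {n} (M : Model n) (C : Coalition n) (φ ψ : Form n) →
          (∀ {t} → M , t ⊨ φ → M , t ⊨ ψ) →
          ∀ {s} → M , s ⊨ [ C ]' φ → M , s ⊨ [ C ]' ψ
[]-mono M C φ ψ φ⇒ψ (σ , forces) = σ , λ τ → φ⇒ψ (forces τ)

Iab-antimono : ∀ {n} (M : Model n) (C : Coalition n) (φ ψ : Form n) →
               (∀ {t} → M , t ⊨ φ → M , t ⊨ ψ) →
               ∀ {s} → M , s ⊨ Iab C ψ → M , s ⊨ Iab C φ
Iab-antimono M C φ ψ φ⇒ψ unableψ ableφ = unableψ ([]-mono M C φ ψ φ⇒ψ ableφ)

⇒-intro-¬ : ∀ {n} (M : Model n) {t} (φ ψ : Form n) →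
        M , t ⊨ ¬' φ → M , t ⊨ (φ ⇒' ψ)
⇒-intro-¬ M φ ψ ¬φ (φ-holds , _) = ¬φ φ-holds

⇒-intro : ∀ {n} (M : Model n) {t} (φ ψ : Form n) →
      M , t ⊨ ψ → M , t ⊨ (φ ⇒' ψ)
⇒-intro M φ ψ ψ-holds (_ , ¬ψ) = ¬ψ ψ-holds

theorem4p14 : (k : ℕ) (C : Coalition (suc k)) (φ ψ : Form (suc k)) →
    Valid (Iab C (φ ⇒' ψ) ⇒' (Iab C (¬' φ) ∧' Iab C ψ))
theorem4p14 k C φ ψ M s (unable , fails-conclusion) =
  fails-conclusion ( Iab-antimono M C (¬' φ) (φ ⇒' ψ) (⇒-intro-¬ M φ ψ) unable
                   , Iab-antimono M C ψ (φ ⇒' ψ) (⇒-intro M φ ψ) unable )
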